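{- Let $S=\langle 6,9,20\rangle=\{6x_1+9x_2+20x_3 : x_1,x_2,x_3\in\mathbb{N}_0\}$ (the Chicken McNugget monoid). Then $\operatorname{c}(S)=7$ and $\operatorname{t}(S)=10$.
   Context: For $n\in S$, a factorization of $n$ is a triple $(x_1,x_2,x_3)\in\mathbb{N}_0^3$ with $n=6x_1+9x_2+20x_3$, and $\mathsf{Z}(n)$ is the set of all factorizations of $n$; the length of $z=(x_1,x_2,x_3)$ is $|z|=x_1+x_2+x_3$. For $z=(x_i), z'=(y_i)\in\mathsf{Z}(n)$, $z\wedge z'=(\min(x_i,y_i))_i$ and $\mathbf{d}(z,z')=\max\{|z|,|z'|\}-|z\wedge z'|$. An $N$-chain is a sequence $z_0,\ldots,z_t$ in $\mathsf{Z}(n)$ with $\mathbf{d}(z_{i-1},z_i)\le N$ for all $i$. The catenary degree $\operatorname{c}(n)$ is the least $N\ge0$ such that any two elements of $\mathsf{Z}(n)$ are joined by an $N$-chain, and $\operatorname{c}(S)=\sup_{n\in S}\operatorname{c}(n)$. Writing $n_1=6,n_2=9,n_3=20$: for each $i$ with $n-n_i\in S$, $\operatorname{t}(n,n_i)$ is the least $t\ge0$ such that every $z\in\mathsf{Z}(n)$ is within distance $t$ of some $z'=(y_1,y_2,y_3)\in\mathsf{Z}(n)$ with $y_i\ne0$; if $n-n_i\notin S$ then $\operatorname{t}(n,n_i)=0$. The tame degree is $\operatorname{t}(n)=\max_i \operatorname{t}(n,n_i)$ and $\operatorname{t}(S)=\sup_{n\in S}\operatorname{t}(n)$. -}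

module Defs where

open import Data.Nat using (ℕ; zero; suc; _+_; _*_; _∸_; _≤_; _⊔_; _⊓_)
open import Data.Fin using (Fin; zero; suc)
open import Data.Product using (Σ; _×_; _,_; ∃)
open import Relation.Binary.PropositionalEquality using (_≡_; _≢_)
open import Relation.Nullary using (¬_)

Fact : Set
Fact = ℕ × ℕ × ℕ

gen : Fin 3 → ℕ
gen zero = 6
gen (suc zero) = 9
gen (suc (suc zero)) = 20

coord : Fin 3 → Fact → ℕ
coord zero (x₁ , x₂ , x₃) = x₁
coord (suc zero) (x₁ , x₂ , x₃) = x₂
coord (suc (suc zero)) (x₁ , x₂ , x₃) = x₃

eval : Fact → ℕ
eval (x₁ , x₂ , x₃) = 6 * x₁ + 9 * x₂ + 20 * x₃

_∈Z_ : Fact → ℕ → Set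
z ∈Z n = eval z ≡ n

InS : ℕ → Set
InS n = ∃ λ z → z ∈Z n

len : Fact → ℕ
len (x₁ , x₂ , x₃) = x₁ + x₂ + x₃

meet : Fact → Fact → Fact
meet (x₁ , x₂ , x₃) (y₁ , y₂ , y₃) = (x₁ ⊓ y₁ , x₂ ⊓ y₂ , x₃ ⊓ y₃)

dist : Fact → Fact → ℕ
dist z z' = (len z ⊔ len z') ∸ len (meet z z')

data Chain (n N : ℕ) : Fact → Fact → Set where
  done : ∀ {z} → z ∈Z n → Chain n N z z
  step : ∀ {z w z'} → z ∈Z n → dist z w ≤ N → Chain n N w z' → Chain n N z z'

Connected : ℕ → ℕ → Set
Connected n N = ∀ z z' → z ∈Z n → z' ∈Z n → Chain n N z z'

IsCatenaryDegree : ℕ → ℕ → Set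
IsCatenaryDegree n N = Connected n N × (∀ M → Connected n M → N ≤ M)

TameBound : ℕ → Fin 3 → ℕ → Set
TameBound n i t =
  ∀ z → z ∈Z n → ∃ λ z' → z' ∈Z n × coord i z' ≢ 0 × dist z z' ≤ t

MinusGenInS : ℕ → Fin 3 → Set
MinusGenInS n i = gen i ≤ n × InS (n ∸ gen i)

IsLocalTame : ℕ → Fin 3 → ℕ → Set
IsLocalTame n i t =
  (MinusGenInS n i → TameBound n i t × (∀ s → TameBound n i s → t ≤ s))
  × (¬ MinusGenInS n i → t ≡ 0)

IsTameDegree : ℕ → ℕ → Set
IsTameDegree n t = Σ ℕ λ t₁ → Σ ℕ λ t₂ → Σ ℕ λ t₃ →
  IsLocalTame n zero t₁ × IsLocalTame n (suc zero) t₂ × IsLocalTame n (suc (suc zero)) t₃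
  × t ≡ t₁ ⊔ (t₂ ⊔ t₃)

-- sup_{n ∈ S} f(n) = v, where f is given as a relation R n x meaning f(n) = x:
-- f(n) is defined for every n ∈ S, every value is ≤ v, and v is attained
-- (a supremum of natural numbers that is a natural number is attained).
IsSupOverS : (ℕ → ℕ → Set) → ℕ → Set
IsSupOverS R v =
  (∀ n → InS n → ∃ λ x → R n x)
  × (∀ n x → InS n → R n x → x ≤ v)
  × (∃ λ n → InS n × R n v)

-- S = ⟨6, 9, 20⟩ is presented by the trades 3·6 = 2·9, of length 3, and 6 + 6·9 = 3·20, of
-- length 7. With them every factorization is joined by a 7-chain to a canonical one, having
-- x₁ ≤ 2 and x₂ < 8 (if x₁ = 0) or x₂ < 6; the twenty possible values of 6x₁ + 9x₂ are distinct
-- modulo 20, so each element has exactly one canonical factorization, and c(S) ≤ 7. A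
-- factorization not using nᵢ reaches one using it by a single trade of length ≤ 10 (such as
-- 10·6 = 3·20), except for finitely many small n, for which n − nᵢ ∉ S; so t(S) ≤ 10. Both
-- bounds are attained at 60: its factorization 3·20 is at distance ≥ 7 from the other four
-- and is the only one using 20, at distance 10 from 10·6. Since Z(n) is finite, connectivity
-- and tameness are decidable, so c(n) and t(n, nᵢ) exist as least elements.

module Submission where

open import Defs
open import Data.Nat using (ℕ; zero; suc; _+_; _*_; _∸_; _≤_; _<_; _⊔_; _≤?_; _≟_; z≤n; s≤s; _<ᵇ_)
open import Data.Nat.Properties
open import Data.Nat.Divisibility using (_∣_; _∣?_; divides; quotient; m∣m*n)
open import Data.Nat.DivMod using (_%_; [m+kn]%n≡m%n)
open import Data.Nat.Solver using (module +-*-Solver)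
open import Data.Fin using (Fin; zero; suc)
open import Data.Product using (Σ; _×_; _,_; ∃; proj₂)
open import Data.Product.Properties using (≡-dec)
open import Data.Sum using (_⊎_; inj₁; inj₂; [_,_]′)
open import Data.Bool using (T)
open import Data.Unit using (tt)
open import Data.Empty using (⊥; ⊥-elim)
open import Data.List using (List; []; _∷_; concatMap; upTo; length; filter)
open import Data.List.Properties using (length-filter)
open import Data.List.Relation.Unary.Any as Any using (Any; here; there)
open import Data.List.Relation.Unary.All as All using (All)
open import Data.List.Relation.Unary.All.Properties using (¬All⇒Any¬)
open import Data.List.Membership.Propositional using (_∈_; find; lose)
open import Data.List.Membership.Propositional.Properties using (∈-concatMap⁺; ∈-concatMap⁻; ∈-upTo⁺)
open import Relation.Binary.Definitions using (DecidableEquality)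
open import Relation.Binary.PropositionalEquality
open import Relation.Nullary using (¬_; Dec; yes; no; contradiction)
open import Relation.Nullary.Decidable using (map′; _⊎-dec_; _×-dec_; _→-dec_; ¬?; True; False; toWitness; toWitnessFalse; decidable-stable)
open import Relation.Unary using (Pred; Decidable)
open import Level using (0ℓ)
open import Function using (id)

module _ {P : Pred ℕ 0ℓ} (P? : Decidable P) where

  Least : ℕ → Set
  Least t = P t × (∀ s → P s → t ≤ s)

  least-below : ∀ B → ∃ Least ⊎ (∀ s → s < B → ¬ P s)
  least-below zero = inj₂ λ _ ()
  least-below (suc B) with least-below B
  ... | inj₁ min = inj₁ min
  ... | inj₂ none with P? B
  ...   | yes pB  = inj₁ (B , pB , λ s ps → ≮⇒≥ λ s<B → none s s<B ps)
  ...   | no ¬pB  = inj₂ λ s s<1+B ps →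
          [ (λ s<B → none s s<B ps) , (λ { refl → ¬pB ps }) ]′ (m<1+n⇒m<n∨m≡n s<1+B)

  least : ∀ {B} → P B → ∃ Least
  least {B} pB = [ id , (λ none → contradiction pB (none B ≤-refl)) ]′ (least-below (suc B))

module _ {A : Set} {P Q : Pred A 0ℓ} (P? : Decidable P) (Q? : Decidable Q) (P⊆Q : ∀ {x} → P x → Q x) where

  length-filter-mono : ∀ xs → length (filter P? xs) ≤ length (filter Q? xs)
  length-filter-mono [] = z≤n
  length-filter-mono (x ∷ xs) with P? x | Q? x
  ... | yes _  | yes _   = s≤s (length-filter-mono xs)
  ... | yes px | no ¬qx  = contradiction (P⊆Q px) ¬qx
  ... | no _   | yes _   = m≤n⇒m≤1+n (length-filter-mono xs)
  ... | no _   | no _    = length-filter-mono xs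

  length-filter-strictMono : ∀ xs → Any (λ x → Q x × ¬ P x) xs → length (filter P? xs) < length (filter Q? xs)
  length-filter-strictMono (x ∷ xs) (here (qx , ¬px)) with P? x | Q? x
  ... | yes px | _      = contradiction px ¬px
  ... | no _   | yes _  = s≤s (length-filter-mono xs)
  ... | no _   | no ¬qx = contradiction qx ¬qx
  length-filter-strictMono (x ∷ xs) (there any) with P? x | Q? x
  ... | yes _  | yes _  = s≤s (length-filter-strictMono xs any)
  ... | yes px | no ¬qx = contradiction (P⊆Q px) ¬qx
  ... | no _   | yes _  = m≤n⇒m≤1+n (length-filter-strictMono xs any)
  ... | no _   | no _   = length-filter-strictMono xs any

infixl 6 _⊕_
_⊕_ : Fact → Fact → Fact
(a , b , c) ⊕ (x , y , z) = (a + x , b + y , c + z)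

⊕-comm : ∀ d u → d ⊕ u ≡ u ⊕ d
⊕-comm (a , b , c) (x , y , z) = cong₂ _,_ (+-comm a x) (cong₂ _,_ (+-comm b y) (+-comm c z))

eval-⊕ : ∀ d u → eval (d ⊕ u) ≡ eval d + eval u
eval-⊕ (a , b , c) (x , y , z) = solve 6
  (λ a b c x y z → con 6 :* (a :+ x) :+ con 9 :* (b :+ y) :+ con 20 :* (c :+ z)
               := (con 6 :* a :+ con 9 :* b :+ con 20 :* c) :+ (con 6 :* x :+ con 9 :* y :+ con 20 :* z))
  refl a b c x y z
  where open +-*-Solver

len-⊕ : ∀ d u → len (d ⊕ u) ≡ len d + len u
len-⊕ (a , b , c) (x , y , z) = solve 6
  (λ a b c x y z → (a :+ x) :+ (b :+ y) :+ (c :+ z) := (a :+ b :+ c) :+ (x :+ y :+ z))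
  refl a b c x y z
  where open +-*-Solver

⊕-distribˡ-meet : ∀ u d e → u ⊕ meet d e ≡ meet (u ⊕ d) (u ⊕ e)
⊕-distribˡ-meet (x , y , z) (a , b , c) (a′ , b′ , c′) =
  cong₂ _,_ (+-distribˡ-⊓ x a a′) (cong₂ _,_ (+-distribˡ-⊓ y b b′) (+-distribˡ-⊓ z c c′))

meet-comm : ∀ z w → meet z w ≡ meet w z
meet-comm (a , b , c) (x , y , z) = cong₂ _,_ (⊓-comm a x) (cong₂ _,_ (⊓-comm b y) (⊓-comm c z))

meet-idem : ∀ z → meet z z ≡ z
meet-idem (a , b , c) = cong₂ _,_ (⊓-idem a) (cong₂ _,_ (⊓-idem b) (⊓-idem c))

dist-⊕ˡ : ∀ u d e → dist (u ⊕ d) (u ⊕ e) ≡ dist d e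
dist-⊕ˡ u d e = begin
  (len (u ⊕ d) ⊔ len (u ⊕ e)) ∸ len (meet (u ⊕ d) (u ⊕ e))
    ≡⟨ cong₂ _∸_ (cong₂ _⊔_ (len-⊕ u d) (len-⊕ u e))
                 (trans (cong len (sym (⊕-distribˡ-meet u d e))) (len-⊕ u (meet d e))) ⟩
  ((len u + len d) ⊔ (len u + len e)) ∸ (len u + len (meet d e))
    ≡⟨ cong (_∸ (len u + len (meet d e))) (+-distribˡ-⊔ (len u) (len d) (len e)) ⟨
  (len u + (len d ⊔ len e)) ∸ (len u + len (meet d e))
    ≡⟨ [m+n]∸[m+o]≡n∸o (len u) (len d ⊔ len e) (len (meet d e)) ⟩
  dist d e ∎
  where open ≡-Reasoning

dist-sym : ∀ z w → dist z w ≡ dist w z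
dist-sym z w = cong₂ _∸_ (⊔-comm (len z) (len w)) (cong len (meet-comm z w))

dist-self≡0 : ∀ z → dist z z ≡ 0
dist-self≡0 z = trans (cong₂ _∸_ (⊔-idem (len z)) (cong len (meet-idem z))) (n∸n≡0 (len z))

dist-⊕ʳ : ∀ u d e → dist (d ⊕ u) (e ⊕ u) ≡ dist d e
dist-⊕ʳ u d e = trans (cong₂ dist (⊕-comm d u) (⊕-comm e u)) (dist-⊕ˡ u d e)

trade-∈Z : ∀ {n d e} u → eval d ≡ eval e → (d ⊕ u) ∈Z n → (e ⊕ u) ∈Z n
trade-∈Z {d = d} {e} u d≡e d⊕u∈Z = begin
  eval (e ⊕ u)      ≡⟨ eval-⊕ e u ⟩
  eval e + eval u   ≡⟨ cong (_+ eval u) d≡e ⟨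
  eval d + eval u   ≡⟨ eval-⊕ d u ⟨
  eval (d ⊕ u)      ≡⟨ d⊕u∈Z ⟩
  _                 ∎
  where open ≡-Reasoning

_≟ᶠ_ : DecidableEquality Fact
_≟ᶠ_ = ≡-dec _≟_ (≡-dec _≟_ _≟_)

head∈Z : ∀ {n N a b} → Chain n N a b → a ∈Z n
head∈Z (done a∈Z)     = a∈Z
head∈Z (step a∈Z _ _) = a∈Z

last∈Z : ∀ {n N a b} → Chain n N a b → b ∈Z n
last∈Z (done b∈Z)   = b∈Z
last∈Z (step _ _ c) = last∈Z c

infixr 5 _++ᶜ_
_++ᶜ_ : ∀ {n N a b c} → Chain n N a b → Chain n N b c → Chain n N a c
done _     ++ᶜ c′ = c′
step p d c ++ᶜ c′ = step p d (c ++ᶜ c′)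

reverseᶜ : ∀ {n N a b} → Chain n N a b → Chain n N b a
reverseᶜ (done p) = done p
reverseᶜ {N = N} (step {z} {w} p d c) =
  reverseᶜ c ++ᶜ step (head∈Z c) (subst (_≤ N) (dist-sym z w) d) (done p)

chain-departs : ∀ {n M a b} → Chain n M a b → a ≢ b →
                ∃ λ w → w ∈Z n × a ≢ w × dist a w ≤ M
chain-departs (done _) a≢a = contradiction refl a≢a
chain-departs {a = a} (step {w = w} _ d c) a≢b with a ≟ᶠ w
... | yes refl = chain-departs c a≢b
... | no a≢w   = w , head∈Z c , a≢w , d

candidates : ℕ → ℕ → ℕ → List Fact
candidates n b c with 9 * b + 20 * c ≤? n | 6 ∣? (n ∸ (9 * b + 20 * c))
... | yes _ | yes 6∣r = (quotient 6∣r , b , c) ∷ []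
... | _     | _       = []

factorizations : ℕ → List Fact
factorizations n = concatMap (λ c → concatMap (λ b → candidates n b c) (upTo (suc n))) (upTo (suc n))

eval≡6a+s : ∀ a b c → eval (a , b , c) ≡ 6 * a + (9 * b + 20 * c)
eval≡6a+s a b c = +-assoc (6 * a) (9 * b) (20 * c)

∈-candidates⁻ : ∀ {n b c z} → z ∈ candidates n b c → z ∈Z n
∈-candidates⁻ {n} {b} {c} z∈ with 9 * b + 20 * c ≤? n | 6 ∣? (n ∸ (9 * b + 20 * c))
∈-candidates⁻ {n} {b} {c} (here refl) | yes s≤n | yes (divides q r≡q*6) = begin
  eval (q , b , c)             ≡⟨ eval≡6a+s q b c ⟩
  6 * q + s                    ≡⟨ cong (_+ s) (trans (*-comm 6 q) (sym r≡q*6)) ⟩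
  (n ∸ s) + s                  ≡⟨ m∸n+n≡m s≤n ⟩
  n                            ∎
  where open ≡-Reasoning
        s = 9 * b + 20 * c
∈-candidates⁻ () | yes _ | no _
∈-candidates⁻ () | no _  | _

∈-candidates⁺ : ∀ a b c → (a , b , c) ∈ candidates (eval (a , b , c)) b c
∈-candidates⁺ a b c rewrite eval≡6a+s a b c
  with 9 * b + 20 * c ≤? 6 * a + (9 * b + 20 * c) | 6 ∣? (6 * a + (9 * b + 20 * c) ∸ (9 * b + 20 * c))
... | yes _   | yes (divides q r≡q*6) =
  here (cong (λ x → x , b , c) (*-cancelʳ-≡ a q 6 (trans (*-comm a 6) (trans (sym (m+n∸n≡m (6 * a) (9 * b + 20 * c))) r≡q*6))))
... | yes _   | no 6∤r  = contradiction (subst (6 ∣_) (sym (m+n∸n≡m (6 * a) (9 * b + 20 * c))) (m∣m*n a)) 6∤r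
... | no s≰n  | _       = contradiction (m≤n+m (9 * b + 20 * c) (6 * a)) s≰n

∈-factorizations⁻ : ∀ {n z} → z ∈ factorizations n → z ∈Z n
∈-factorizations⁻ {n} z∈ =
  let c , z∈c = Any.satisfied (∈-concatMap⁻ (λ c → concatMap (λ b → candidates n b c) (upTo (suc n))) {xs = upTo (suc n)} z∈)
      b , z∈b = Any.satisfied (∈-concatMap⁻ (λ b → candidates n b c) {xs = upTo (suc n)} z∈c)
  in ∈-candidates⁻ z∈b

∈-factorizations⁺ : ∀ {n z} → z ∈Z n → z ∈ factorizations n
∈-factorizations⁺ {z = a , b , c} refl =
  ∈-concatMap⁺ (λ c → concatMap (λ b → candidates n b c) (upTo (suc n)))
    (lose (∈-upTo⁺ (s≤s c≤n))
      (∈-concatMap⁺ (λ b → candidates n b c) (lose (∈-upTo⁺ (s≤s b≤n)) (∈-candidates⁺ a b c))))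
  where
  n = eval (a , b , c)
  c≤n : c ≤ n
  c≤n = ≤-trans (m≤n*m c 20) (m≤n+m (20 * c) (6 * a + 9 * b))
  b≤n : b ≤ n
  b≤n = ≤-trans (m≤n*m b 9) (≤-trans (m≤n+m (9 * b) (6 * a)) (m≤m+n (6 * a + 9 * b) (20 * c)))

module _ {P : Pred Fact 0ℓ} (P? : Decidable P) (n : ℕ) where

  ∀-factorization? : Dec (∀ z → z ∈Z n → P z)
  ∀-factorization? = map′
    (λ all z z∈Z → All.lookup all (∈-factorizations⁺ z∈Z))
    (λ ∀P → All.tabulate (λ z∈ → ∀P _ (∈-factorizations⁻ z∈)))
    (All.all? P? (factorizations n))

  ∃-factorization? : Dec (∃ λ z → z ∈Z n × P z)
  ∃-factorization? = map′
    (λ any → let z , z∈ , pz = find any in z , ∈-factorizations⁻ z∈ , pz)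
    (λ (z , z∈Z , pz) → lose (∈-factorizations⁺ z∈Z) pz)
    (Any.any? P? (factorizations n))

all-factorizations : ∀ {P : Pred Fact 0ℓ} (P? : Decidable P) n → {True (∀-factorization? P? n)} →
                     ∀ z → z ∈Z n → P z
all-factorizations P? n {holds} = toWitness holds

InS? : ∀ n → Dec (InS n)
InS? n = map′ (λ (z , z∈Z , _) → z , z∈Z) (λ (z , z∈Z) → z , z∈Z , tt) (∃-factorization? (λ _ → yes tt) n)

MinusGenInS? : ∀ n i → Dec (MinusGenInS n i)
MinusGenInS? n i = gen i ≤? n ×-dec InS? (n ∸ gen i)

excluded : ∀ {n} i → MinusGenInS n i → {False (MinusGenInS? n i)} → ⊥
excluded i m {n∉} = toWitnessFalse n∉ m

TameBound? : ∀ n i t → Dec (TameBound n i t)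
TameBound? n i t = ∀-factorization? (λ z → ∃-factorization? (λ z′ → ¬? (coord i z′ ≟ 0) ×-dec dist z z′ ≤? t) n) n

module Connectivity {n : ℕ} (M : ℕ) (t : Fact) (t∈Z : t ∈Z n) where

  Z : List Fact
  Z = factorizations n

  ReachesIn : ℕ → Pred Fact 0ℓ
  ReachesIn zero    z = z ≡ t
  ReachesIn (suc k) z = ReachesIn k z ⊎ Any (λ w → dist z w ≤ M × ReachesIn k w) Z

  reachesIn? : ∀ k → Decidable (ReachesIn k)
  reachesIn? zero    z = z ≟ᶠ t
  reachesIn? (suc k) z = reachesIn? k z ⊎-dec Any.any? (λ w → dist z w ≤? M ×-dec reachesIn? k w) Z

  t-reachesIn : ∀ k → ReachesIn k t
  t-reachesIn zero    = refl
  t-reachesIn (suc k) = inj₁ (t-reachesIn k)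

  reachesIn⇒chain : ∀ k {z} → z ∈Z n → ReachesIn k z → Chain n M z t
  reachesIn⇒chain zero    z∈Z refl        = done z∈Z
  reachesIn⇒chain (suc k) z∈Z (inj₁ r)    = reachesIn⇒chain k z∈Z r
  reachesIn⇒chain (suc k) z∈Z (inj₂ any) =
    let w , w∈ , d , r = find any in step z∈Z d (reachesIn⇒chain k (∈-factorizations⁻ w∈) r)

  Stable : ℕ → Set
  Stable k = All (λ z → ReachesIn (suc k) z → ReachesIn k z) Z

  stable-closed : ∀ {k a b} → Stable k → Chain n M a b → ReachesIn k a → ReachesIn k b
  stable-closed st (done _) r = r
  stable-closed {a = a} st (step {w = w} a∈Z d c) r = stable-closed st c
    (All.lookup st (∈-factorizations⁺ (head∈Z c))
      (inj₂ (lose (∈-factorizations⁺ a∈Z) (subst (_≤ M) (dist-sym a w) d , r))))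

  reached : ℕ → ℕ
  reached k = length (filter (reachesIn? k) Z)

  -- Each unstable round reaches a new factorization, and Z(n) has only finitely many.
  stabilizes : ∀ fuel k → k ≤ reached k → fuel + k ≡ suc (length Z) → ∃ Stable
  stabilizes zero    k k≤r refl = contradiction (≤-trans k≤r (length-filter (reachesIn? k) Z)) (n≮n (length Z))
  stabilizes (suc f) k k≤r f+k≡ with All.all? (λ z → reachesIn? (suc k) z →-dec reachesIn? k z) Z
  ... | yes st = k , st
  ... | no ¬st = stabilizes f (suc k) (≤-trans (s≤s k≤r) grows) (trans (+-suc f k) f+k≡)
    where
    grows : reached k < reached (suc k)
    grows = length-filter-strictMono (reachesIn? k) (reachesIn? (suc k)) inj₁ Z
      (Any.map newlyReached (¬All⇒Any¬ (λ z → reachesIn? (suc k) z →-dec reachesIn? k z) Z ¬st))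
      where
      newlyReached : ∀ {z} → ¬ (ReachesIn (suc k) z → ReachesIn k z) → ReachesIn (suc k) z × ¬ ReachesIn k z
      newlyReached {z} ¬imp =
        decidable-stable (reachesIn? (suc k) z) (λ ¬r → ¬imp (λ r → contradiction r ¬r)) , λ r → ¬imp (λ _ → r)

  connected? : Dec (Connected n M)
  connected? with stabilizes (suc (length Z)) 0 z≤n (+-identityʳ _)
  ... | k , st with All.all? (reachesIn? k) Z
  ... | yes all = yes λ z z′ z∈Z z′∈Z →
          reachesIn⇒chain k z∈Z (All.lookup all (∈-factorizations⁺ z∈Z))
          ++ᶜ reverseᶜ (reachesIn⇒chain k z′∈Z (All.lookup all (∈-factorizations⁺ z′∈Z)))
  ... | no ¬all = let z , z∈ , ¬r = find (¬All⇒Any¬ (reachesIn? k) Z ¬all) in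
          no λ conn → ¬r (stable-closed st (conn t z t∈Z (∈-factorizations⁻ z∈)) (t-reachesIn k))

trade-step : ∀ {n N b} d e u → eval d ≡ eval e → {True (dist d e ≤? N)} →
             (d ⊕ u) ∈Z n → Chain n N (e ⊕ u) b → Chain n N (d ⊕ u) b
trade-step {N = N} d e u _ {d≤N} d⊕u∈Z =
  step d⊕u∈Z (subst (_≤ N) (sym (dist-⊕ʳ u d e)) (toWitness d≤N))

data Canonical : Fact → Set where
  canonical₀ : ∀ {b c} → T (b <ᵇ 8) → Canonical (0 , b , c)
  canonical₁ : ∀ {b c} → T (b <ᵇ 6) → Canonical (1 , b , c)
  canonical₂ : ∀ {b c} → T (b <ᵇ 6) → Canonical (2 , b , c)

ToCanonical : ℕ → Fact → Set
ToCanonical n z = Σ Fact λ w → Canonical w × Chain n 7 z w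

via : ∀ {n} d e u → eval d ≡ eval e → {True (dist d e ≤? 7)} → (d ⊕ u) ∈Z n →
      ((e ⊕ u) ∈Z n → ToCanonical n (e ⊕ u)) → ToCanonical n (d ⊕ u)
via d e u d≡e {d≤7} d⊕u∈Z continue =
  let w , canonical , chain = continue (trade-∈Z {d = d} {e} u d≡e d⊕u∈Z)
  in w , canonical , trade-step d e u d≡e {d≤7} d⊕u∈Z chain

toCanonical₀ : ∀ {n} b c → (0 , b , c) ∈Z n → ToCanonical n (0 , b , c)
toCanonical₁ : ∀ {n} b c → (1 , b , c) ∈Z n → ToCanonical n (1 , b , c)
toCanonical₂ : ∀ {n} b c → (2 , b , c) ∈Z n → ToCanonical n (2 , b , c)

toCanonical₀ (suc (suc (suc (suc (suc (suc (suc (suc b)))))))) c z∈Z =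
  via (0 , 2 , 0) (3 , 0 , 0) (0 , 6 + b , c) refl z∈Z λ z∈Z →
  via (1 , 6 , 0) (0 , 0 , 3) (2 , b , c) refl z∈Z λ z∈Z →
  toCanonical₂ b (3 + c) z∈Z
toCanonical₀ 0 c z∈Z = _ , canonical₀ tt , done z∈Z
toCanonical₀ 1 c z∈Z = _ , canonical₀ tt , done z∈Z
toCanonical₀ 2 c z∈Z = _ , canonical₀ tt , done z∈Z
toCanonical₀ 3 c z∈Z = _ , canonical₀ tt , done z∈Z
toCanonical₀ 4 c z∈Z = _ , canonical₀ tt , done z∈Z
toCanonical₀ 5 c z∈Z = _ , canonical₀ tt , done z∈Z
toCanonical₀ 6 c z∈Z = _ , canonical₀ tt , done z∈Z
toCanonical₀ 7 c z∈Z = _ , canonical₀ tt , done z∈Z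

toCanonical₁ (suc (suc (suc (suc (suc (suc b)))))) c z∈Z =
  via (1 , 6 , 0) (0 , 0 , 3) (0 , b , c) refl z∈Z λ z∈Z → toCanonical₀ b (3 + c) z∈Z
toCanonical₁ 0 c z∈Z = _ , canonical₁ tt , done z∈Z
toCanonical₁ 1 c z∈Z = _ , canonical₁ tt , done z∈Z
toCanonical₁ 2 c z∈Z = _ , canonical₁ tt , done z∈Z
toCanonical₁ 3 c z∈Z = _ , canonical₁ tt , done z∈Z
toCanonical₁ 4 c z∈Z = _ , canonical₁ tt , done z∈Z
toCanonical₁ 5 c z∈Z = _ , canonical₁ tt , done z∈Z

toCanonical₂ (suc (suc (suc (suc (suc (suc b)))))) c z∈Z =
  via (1 , 6 , 0) (0 , 0 , 3) (1 , b , c) refl z∈Z λ z∈Z → toCanonical₁ b (3 + c) z∈Z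
toCanonical₂ 0 c z∈Z = _ , canonical₂ tt , done z∈Z
toCanonical₂ 1 c z∈Z = _ , canonical₂ tt , done z∈Z
toCanonical₂ 2 c z∈Z = _ , canonical₂ tt , done z∈Z
toCanonical₂ 3 c z∈Z = _ , canonical₂ tt , done z∈Z
toCanonical₂ 4 c z∈Z = _ , canonical₂ tt , done z∈Z
toCanonical₂ 5 c z∈Z = _ , canonical₂ tt , done z∈Z

toCanonical : ∀ {n} a b c → (a , b , c) ∈Z n → ToCanonical n (a , b , c)
toCanonical (suc (suc (suc a))) b c z∈Z =
  via (3 , 0 , 0) (0 , 2 , 0) (a , b , c) refl z∈Z λ z∈Z → toCanonical a (2 + b) c z∈Z
toCanonical 0 = toCanonical₀
toCanonical 1 = toCanonical₁
toCanonical 2 = toCanonical₂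

decodeResidue : ℕ → ℕ × ℕ
decodeResidue 0  = 0 , 0
decodeResidue 9  = 0 , 1
decodeResidue 18 = 0 , 2
decodeResidue 7  = 0 , 3
decodeResidue 16 = 0 , 4
decodeResidue 5  = 0 , 5
decodeResidue 14 = 0 , 6
decodeResidue 3  = 0 , 7
decodeResidue 6  = 1 , 0
decodeResidue 15 = 1 , 1
decodeResidue 4  = 1 , 2
decodeResidue 13 = 1 , 3
decodeResidue 2  = 1 , 4
decodeResidue 11 = 1 , 5
decodeResidue 12 = 2 , 0
decodeResidue 1  = 2 , 1
decodeResidue 10 = 2 , 2
decodeResidue 19 = 2 , 3
decodeResidue 8  = 2 , 4
decodeResidue 17 = 2 , 5
decodeResidue _  = 0 , 0

[m+20c]%20≡m%20 : ∀ m c → (m + 20 * c) % 20 ≡ m % 20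
[m+20c]%20≡m%20 m c = trans (cong (λ x → (m + x) % 20) (*-comm 20 c)) ([m+kn]%n≡m%n m c 20)

decodeResidue-canonical : ∀ {a b c} → Canonical (a , b , c) → decodeResidue (eval (a , b , c) % 20) ≡ (a , b)
decodeResidue-canonical {c = c} (canonical₀ {0} _) = cong decodeResidue ([m+20c]%20≡m%20 0 c)
decodeResidue-canonical {c = c} (canonical₀ {1} _) = cong decodeResidue ([m+20c]%20≡m%20 9 c)
decodeResidue-canonical {c = c} (canonical₀ {2} _) = cong decodeResidue ([m+20c]%20≡m%20 18 c)
decodeResidue-canonical {c = c} (canonical₀ {3} _) = cong decodeResidue ([m+20c]%20≡m%20 27 c)
decodeResidue-canonical {c = c} (canonical₀ {4} _) = cong decodeResidue ([m+20c]%20≡m%20 36 c)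
decodeResidue-canonical {c = c} (canonical₀ {5} _) = cong decodeResidue ([m+20c]%20≡m%20 45 c)
decodeResidue-canonical {c = c} (canonical₀ {6} _) = cong decodeResidue ([m+20c]%20≡m%20 54 c)
decodeResidue-canonical {c = c} (canonical₀ {7} _) = cong decodeResidue ([m+20c]%20≡m%20 63 c)
decodeResidue-canonical {c = c} (canonical₁ {0} _) = cong decodeResidue ([m+20c]%20≡m%20 6 c)
decodeResidue-canonical {c = c} (canonical₁ {1} _) = cong decodeResidue ([m+20c]%20≡m%20 15 c)
decodeResidue-canonical {c = c} (canonical₁ {2} _) = cong decodeResidue ([m+20c]%20≡m%20 24 c)
decodeResidue-canonical {c = c} (canonical₁ {3} _) = cong decodeResidue ([m+20c]%20≡m%20 33 c)
decodeResidue-canonical {c = c} (canonical₁ {4} _) = cong decodeResidue ([m+20c]%20≡m%20 42 c)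
decodeResidue-canonical {c = c} (canonical₁ {5} _) = cong decodeResidue ([m+20c]%20≡m%20 51 c)
decodeResidue-canonical {c = c} (canonical₂ {0} _) = cong decodeResidue ([m+20c]%20≡m%20 12 c)
decodeResidue-canonical {c = c} (canonical₂ {1} _) = cong decodeResidue ([m+20c]%20≡m%20 21 c)
decodeResidue-canonical {c = c} (canonical₂ {2} _) = cong decodeResidue ([m+20c]%20≡m%20 30 c)
decodeResidue-canonical {c = c} (canonical₂ {3} _) = cong decodeResidue ([m+20c]%20≡m%20 39 c)
decodeResidue-canonical {c = c} (canonical₂ {4} _) = cong decodeResidue ([m+20c]%20≡m%20 48 c)
decodeResidue-canonical {c = c} (canonical₂ {5} _) = cong decodeResidue ([m+20c]%20≡m%20 57 c)

canonical-unique : ∀ {z w} → Canonical z → Canonical w → eval z ≡ eval w → z ≡ w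
canonical-unique {a , b , c} {a′ , b′ , c′} cz cw z≡w
  with trans (sym (decodeResidue-canonical cz))
             (trans (cong (λ m → decodeResidue (m % 20)) z≡w) (decodeResidue-canonical cw))
... | refl = cong (λ x → a , b , x) (*-cancelˡ-≡ c c′ 20 (+-cancelˡ-≡ (6 * a + 9 * b) _ _ z≡w))

connected₇ : ∀ n → Connected n 7
connected₇ n (a , b , c) (a′ , b′ , c′) z∈Z z′∈Z =
  let w  , canonical  , chain  = toCanonical a b c z∈Z
      w′ , canonical′ , chain′ = toCanonical a′ b′ c′ z′∈Z
      w≡w′ = canonical-unique canonical canonical′ (trans (last∈Z chain) (sym (last∈Z chain′)))
  in chain ++ᶜ subst (λ x → Chain n 7 x (a′ , b′ , c′)) (sym w≡w′) (reverseᶜ chain′)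

TameWitness : ℕ → Fin 3 → ℕ → Fact → Set
TameWitness n i t z = ∃ λ z′ → z′ ∈Z n × coord i z′ ≢ 0 × dist z z′ ≤ t

tame-self : ∀ {n t} i z → z ∈Z n → coord i z ≢ 0 → TameWitness n i t z
tame-self {t = t} i z z∈Z zᵢ≢0 = z , z∈Z , zᵢ≢0 , subst (_≤ t) (sym (dist-self≡0 z)) z≤n

tame-trade : ∀ {n t} i d e u → eval d ≡ eval e → {True (dist d e ≤? t)} →
             coord i (e ⊕ u) ≢ 0 → (d ⊕ u) ∈Z n → TameWitness n i t (d ⊕ u)
tame-trade {t = t} i d e u d≡e {d≤t} eᵢ≢0 d⊕u∈Z =
  e ⊕ u , trade-∈Z {d = d} {e} u d≡e d⊕u∈Z , eᵢ≢0 , subst (_≤ t) (sym (dist-⊕ʳ u d e)) (toWitness d≤t)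

tame₀ : ∀ {n} a b c → (a , b , c) ∈Z n → MinusGenInS n zero → TameWitness n zero 10 (a , b , c)
tame₀ (suc a) b c z∈Z _ = tame-self zero (suc a , b , c) z∈Z (λ ())
tame₀ 0 (suc (suc b)) c z∈Z _ = tame-trade zero (0 , 2 , 0) (3 , 0 , 0) (0 , b , c) refl (λ ()) z∈Z
tame₀ 0 b (suc (suc (suc c))) z∈Z _ = tame-trade zero (0 , 0 , 3) (1 , 6 , 0) (0 , b , c) refl (λ ()) z∈Z
tame₀ 0 0 0 refl m = ⊥-elim (excluded zero m)
tame₀ 0 0 1 refl m = ⊥-elim (excluded zero m)
tame₀ 0 0 2 refl m = ⊥-elim (excluded zero m)
tame₀ 0 1 0 refl m = ⊥-elim (excluded zero m)
tame₀ 0 1 1 refl m = ⊥-elim (excluded zero m)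
tame₀ 0 1 2 refl m = ⊥-elim (excluded zero m)

tame₁ : ∀ {n} a b c → (a , b , c) ∈Z n → MinusGenInS n (suc zero) → TameWitness n (suc zero) 10 (a , b , c)
tame₁ a (suc b) c z∈Z _ = tame-self (suc zero) (a , suc b , c) z∈Z (λ ())
tame₁ (suc (suc (suc a))) 0 c z∈Z _ = tame-trade (suc zero) (3 , 0 , 0) (0 , 2 , 0) (a , 0 , c) refl (λ ()) z∈Z
tame₁ a 0 (suc (suc (suc c))) z∈Z _ = tame-trade (suc zero) (0 , 0 , 3) (1 , 6 , 0) (a , 0 , c) refl (λ ()) z∈Z
tame₁ 0 0 0 refl m = ⊥-elim (excluded (suc zero) m)
tame₁ 0 0 1 refl m = ⊥-elim (excluded (suc zero) m)
tame₁ 0 0 2 refl m = ⊥-elim (excluded (suc zero) m)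
tame₁ 1 0 0 refl m = ⊥-elim (excluded (suc zero) m)
tame₁ 1 0 1 refl m = ⊥-elim (excluded (suc zero) m)
tame₁ 1 0 2 refl m = ⊥-elim (excluded (suc zero) m)
tame₁ 2 0 0 refl m = ⊥-elim (excluded (suc zero) m)
tame₁ 2 0 1 refl m = ⊥-elim (excluded (suc zero) m)
tame₁ 2 0 2 refl m = ⊥-elim (excluded (suc zero) m)

tame₂ : ∀ {n} a b c → (a , b , c) ∈Z n → MinusGenInS n (suc (suc zero)) → TameWitness n (suc (suc zero)) 10 (a , b , c)
tame₂ a b (suc c) z∈Z _ = tame-self (suc (suc zero)) (a , b , suc c) z∈Z (λ ())
tame₂ (suc (suc (suc (suc (suc (suc (suc (suc (suc (suc a)))))))))) b 0 z∈Z _ =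
  tame-trade (suc (suc zero)) (10 , 0 , 0) (0 , 0 , 3) (a , b , 0) refl (λ ()) z∈Z
tame₂ (suc (suc (suc (suc (suc (suc (suc a))))))) (suc (suc b)) 0 z∈Z _ =
  tame-trade (suc (suc zero)) (7 , 2 , 0) (0 , 0 , 3) (a , b , 0) refl (λ ()) z∈Z
tame₂ (suc (suc (suc (suc a)))) (suc (suc (suc (suc b)))) 0 z∈Z _ =
  tame-trade (suc (suc zero)) (4 , 4 , 0) (0 , 0 , 3) (a , b , 0) refl (λ ()) z∈Z
tame₂ (suc a) (suc (suc (suc (suc (suc (suc b)))))) 0 z∈Z _ =
  tame-trade (suc (suc zero)) (1 , 6 , 0) (0 , 0 , 3) (a , b , 0) refl (λ ()) z∈Z
tame₂ a (suc (suc (suc (suc (suc (suc (suc (suc b)))))))) 0 z∈Z _ =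
  tame-trade (suc (suc zero)) (0 , 8 , 0) (2 , 0 , 3) (a , b , 0) refl (λ ()) z∈Z
tame₂ 0 0 0 refl m = ⊥-elim (excluded (suc (suc zero)) m)
tame₂ 0 1 0 refl m = ⊥-elim (excluded (suc (suc zero)) m)
tame₂ 0 2 0 refl m = ⊥-elim (excluded (suc (suc zero)) m)
tame₂ 0 3 0 refl m = ⊥-elim (excluded (suc (suc zero)) m)
tame₂ 0 4 0 refl m = ⊥-elim (excluded (suc (suc zero)) m)
tame₂ 0 5 0 refl m = ⊥-elim (excluded (suc (suc zero)) m)
tame₂ 0 6 0 refl m = ⊥-elim (excluded (suc (suc zero)) m)
tame₂ 0 7 0 refl m = ⊥-elim (excluded (suc (suc zero)) m)
tame₂ 1 0 0 refl m = ⊥-elim (excluded (suc (suc zero)) m)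
tame₂ 1 1 0 refl m = ⊥-elim (excluded (suc (suc zero)) m)
tame₂ 1 2 0 refl m = ⊥-elim (excluded (suc (suc zero)) m)
tame₂ 1 3 0 refl m = ⊥-elim (excluded (suc (suc zero)) m)
tame₂ 1 4 0 refl m = ⊥-elim (excluded (suc (suc zero)) m)
tame₂ 1 5 0 refl m = ⊥-elim (excluded (suc (suc zero)) m)
tame₂ 2 0 0 refl m = ⊥-elim (excluded (suc (suc zero)) m)
tame₂ 2 1 0 refl m = ⊥-elim (excluded (suc (suc zero)) m)
tame₂ 2 2 0 refl m = ⊥-elim (excluded (suc (suc zero)) m)
tame₂ 2 3 0 refl m = ⊥-elim (excluded (suc (suc zero)) m)
tame₂ 2 4 0 refl m = ⊥-elim (excluded (suc (suc zero)) m)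
tame₂ 2 5 0 refl m = ⊥-elim (excluded (suc (suc zero)) m)
tame₂ 3 0 0 refl m = ⊥-elim (excluded (suc (suc zero)) m)
tame₂ 3 1 0 refl m = ⊥-elim (excluded (suc (suc zero)) m)
tame₂ 3 2 0 refl m = ⊥-elim (excluded (suc (suc zero)) m)
tame₂ 3 3 0 refl m = ⊥-elim (excluded (suc (suc zero)) m)
tame₂ 3 4 0 refl m = ⊥-elim (excluded (suc (suc zero)) m)
tame₂ 3 5 0 refl m = ⊥-elim (excluded (suc (suc zero)) m)
tame₂ 4 0 0 refl m = ⊥-elim (excluded (suc (suc zero)) m)
tame₂ 4 1 0 refl m = ⊥-elim (excluded (suc (suc zero)) m)
tame₂ 4 2 0 refl m = ⊥-elim (excluded (suc (suc zero)) m)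
tame₂ 4 3 0 refl m = ⊥-elim (excluded (suc (suc zero)) m)
tame₂ 5 0 0 refl m = ⊥-elim (excluded (suc (suc zero)) m)
tame₂ 5 1 0 refl m = ⊥-elim (excluded (suc (suc zero)) m)
tame₂ 5 2 0 refl m = ⊥-elim (excluded (suc (suc zero)) m)
tame₂ 5 3 0 refl m = ⊥-elim (excluded (suc (suc zero)) m)
tame₂ 6 0 0 refl m = ⊥-elim (excluded (suc (suc zero)) m)
tame₂ 6 1 0 refl m = ⊥-elim (excluded (suc (suc zero)) m)
tame₂ 6 2 0 refl m = ⊥-elim (excluded (suc (suc zero)) m)
tame₂ 6 3 0 refl m = ⊥-elim (excluded (suc (suc zero)) m)
tame₂ 7 0 0 refl m = ⊥-elim (excluded (suc (suc zero)) m)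
tame₂ 7 1 0 refl m = ⊥-elim (excluded (suc (suc zero)) m)
tame₂ 8 0 0 refl m = ⊥-elim (excluded (suc (suc zero)) m)
tame₂ 8 1 0 refl m = ⊥-elim (excluded (suc (suc zero)) m)
tame₂ 9 0 0 refl m = ⊥-elim (excluded (suc (suc zero)) m)
tame₂ 9 1 0 refl m = ⊥-elim (excluded (suc (suc zero)) m)

tame-bound₁₀ : ∀ n i → MinusGenInS n i → TameBound n i 10
tame-bound₁₀ n zero             m (a , b , c) z∈Z = tame₀ a b c z∈Z m
tame-bound₁₀ n (suc zero)       m (a , b , c) z∈Z = tame₁ a b c z∈Z m
tame-bound₁₀ n (suc (suc zero)) m (a , b , c) z∈Z = tame₂ a b c z∈Z m

catenaryDegree-exists : ∀ n → InS n → ∃ (IsCatenaryDegree n)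
catenaryDegree-exists n (t , t∈Z) = least (λ M → Connectivity.connected? M t t∈Z) (connected₇ n)

catenaryDegree≤7 : ∀ n x → InS n → IsCatenaryDegree n x → x ≤ 7
catenaryDegree≤7 n x _ (_ , minimal) = minimal 7 (connected₇ n)

-- Z(60) = {(10,0,0), (7,2,0), (4,4,0), (1,6,0), (0,0,3)}.
catenaryDegree-60 : IsCatenaryDegree 60 7
catenaryDegree-60 = connected₇ 60 , λ M connected →
  let w , w∈Z , 003≢w , d≤M = chain-departs (connected (0 , 0 , 3) (10 , 0 , 0) refl refl) (λ ())
  in ≤-trans (isolated w w∈Z 003≢w) d≤M
  where
  isolated : ∀ w → w ∈Z 60 → (0 , 0 , 3) ≢ w → 7 ≤ dist (0 , 0 , 3) w
  isolated = all-factorizations (λ w → ¬? ((0 , 0 , 3) ≟ᶠ w) →-dec 7 ≤? dist (0 , 0 , 3) w) 60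

localTame-exists : ∀ n i → ∃ (IsLocalTame n i)
localTame-exists n i = byCases (MinusGenInS? n i)
  where
  byCases : Dec (MinusGenInS n i) → ∃ (IsLocalTame n i)
  byCases (yes m) = let t , least-t = least {P = TameBound n i} (TameBound? n i) {10} (tame-bound₁₀ n i m)
                    in t , (λ _ → least-t) , (λ ¬m → contradiction m ¬m)
  byCases (no ¬m) = 0 , (λ m → contradiction m ¬m) , (λ _ → refl)

localTame≤10 : ∀ n i t → IsLocalTame n i t → t ≤ 10
localTame≤10 n i t (nontrivial , trivial) = byCases (MinusGenInS? n i)
  where
  byCases : Dec (MinusGenInS n i) → t ≤ 10
  byCases (yes m) = proj₂ (nontrivial m) 10 (tame-bound₁₀ n i m)
  byCases (no ¬m) = subst (_≤ 10) (sym (trivial ¬m)) z≤n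

tameDegree-exists : ∀ n → InS n → ∃ (IsTameDegree n)
tameDegree-exists n _ =
  let t₁ , l₁ = localTame-exists n zero
      t₂ , l₂ = localTame-exists n (suc zero)
      t₃ , l₃ = localTame-exists n (suc (suc zero))
  in t₁ ⊔ (t₂ ⊔ t₃) , t₁ , t₂ , t₃ , l₁ , l₂ , l₃ , refl

tameDegree≤10 : ∀ n x → InS n → IsTameDegree n x → x ≤ 10
tameDegree≤10 n x _ (t₁ , t₂ , t₃ , l₁ , l₂ , l₃ , refl) =
  ⊔-lub (localTame≤10 n zero t₁ l₁)
        (⊔-lub (localTame≤10 n (suc zero) t₂ l₂) (localTame≤10 n (suc (suc zero)) t₃ l₃))

localTame₃-60 : IsLocalTame 60 (suc (suc zero)) 10
localTame₃-60 =
  (λ m → tame-bound₁₀ 60 (suc (suc zero)) m , minimal) , (λ ¬m → contradiction (m≤m+n 20 40 , (0 , 0 , 2) , refl) ¬m)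
  where
  far : ∀ w → w ∈Z 60 → coord (suc (suc zero)) w ≢ 0 → 10 ≤ dist (10 , 0 , 0) w
  far = all-factorizations (λ w → ¬? (coord (suc (suc zero)) w ≟ 0) →-dec 10 ≤? dist (10 , 0 , 0) w) 60
  minimal : ∀ s → TameBound 60 (suc (suc zero)) s → 10 ≤ s
  minimal s bound = let w , w∈Z , w₃≢0 , d≤s = bound (10 , 0 , 0) refl in ≤-trans (far w w∈Z w₃≢0) d≤s

tameDegree-from-localTame₃ : ∀ n → IsLocalTame n (suc (suc zero)) 10 → IsTameDegree n 10
tameDegree-from-localTame₃ n l₃ =
  let t₁ , l₁ = localTame-exists n zero
      t₂ , l₂ = localTame-exists n (suc zero)
  in t₁ , t₂ , 10 , l₁ , l₂ , l₃ ,
     sym (trans (cong (t₁ ⊔_) (m≤n⇒m⊔n≡n (localTame≤10 n (suc zero) t₂ l₂)))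
                (m≤n⇒m⊔n≡n (localTame≤10 n zero t₁ l₁)))

proposition21 : IsSupOverS IsCatenaryDegree 7 × IsSupOverS IsTameDegree 10
proposition21 =
    (catenaryDegree-exists , catenaryDegree≤7 , 60 , ((10 , 0 , 0) , refl) , catenaryDegree-60)
  , (tameDegree-exists , tameDegree≤10 , 60 , ((10 , 0 , 0) , refl) , tameDegree-from-localTame₃ 60 localTame₃-60)
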